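{- Let $f$ be a partial $2$-tone edge $k$-coloring of a graph $G$, let $e=xy$ be an uncolored edge of $G$, and let $L$ be a set of pairwise intersecting candidate labels for $e$. If $|L|>\eta_G(e)$, where $\eta_G(xy)=|N_G(x)\cup N_G(y)|-2$, then $f$ can be extended to $e$ in at least $|L|-\eta_G(e)$ distinct ways.
   Context: All graphs are simple and finite; $N_G(v)$ is the neighborhood of $v$. The distance $d_G(e,e')$ between edges is the distance between the corresponding vertices in the line graph $L(G)$. A partial $2$-tone edge $k$-coloring of $G$ is a map $f:E'\to\binom{\{1,\dots,k\}}{2}$ for some $E'\subseteq E(G)$ such that for all distinct $e,e'\in E'$, $|f(e)\cap f(e')|<d_G(e,e')$; edges outside $E'$ are uncolored. For an uncolored edge $e$, a color is free at $e$ if it does not appear on any colored edge adjacent to $e$; a candidate label for $e$ is a $2$-element set of colors free at $e$. Labels are pairwise intersecting if any two share a color. Extending $f$ to $e$ means assigning $e$ a label so that the result is again a partial $2$-tone edge $k$-coloring. -}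

module Defs where

open import Data.Nat using (ℕ; zero; suc; _+_; _∸_; _<_)
open import Data.Fin using (Fin)
open import Data.Fin.Properties using (_≟_)
open import Data.Bool using (Bool; T; _∨_; if_then_else_)
open import Data.List using (List; map; allFin)
open import Data.Nat.ListAction using (sum)
open import Data.Maybe using (Maybe; just; nothing)
open import Data.Product using (Σ; ∃; _×_; _,_)
open import Data.Sum using (_⊎_)
open import Relation.Nullary using (¬_)
open import Relation.Nullary.Decidable using (⌊_⌋)
open import Relation.Binary.PropositionalEquality using (_≡_)

record Graph (n : ℕ) : Set where
  field
    adj    : Fin n → Fin n → Bool
    sym    : ∀ u v → adj u v ≡ adj v u
    irrefl : ∀ v → adj v v ≡ Data.Bool.false
open Graph public

-- An edge {u,v} of G, stored canonically with u < v.
record Edge {n : ℕ} (G : Graph n) : Set where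
  constructor edge
  field
    src  : Fin n
    tgt  : Fin n
    ord  : Data.Fin._<_ src tgt
    isE  : T (adj G src tgt)
open Edge public

_endOf_ : ∀ {n} {G : Graph n} → Fin n → Edge G → Set
v endOf e = v ≡ src e ⊎ v ≡ tgt e

LAdj : ∀ {n} {G : Graph n} → Edge G → Edge G → Set
LAdj e e' = ¬ (e ≡ e') × ∃ λ v → v endOf e × v endOf e'

-- DistLe m e e' : d_G(e,e') ≤ m, i.e. there is a walk of length ≤ m
-- from e to e' in the line graph.
DistLe : ∀ {n} {G : Graph n} → ℕ → Edge G → Edge G → Set
DistLe zero    e e' = e ≡ e'
DistLe (suc m) e e' = DistLe m e e' ⊎ ∃ λ e'' → LAdj e e'' × DistLe m e'' e'

-- A 2-tone label: a 2-element subset {a,b} of {1..k} (here Fin k), a < b.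
record Label (k : ℕ) : Set where
  constructor label
  field
    c₁  : Fin k
    c₂  : Fin k
    ord : Data.Fin._<_ c₁ c₂
open Label public

_∈L_ : ∀ {k} → Fin k → Label k → Set
c ∈L l = c ≡ c₁ l ⊎ c ≡ c₂ l

private
  b2n : Bool → ℕ
  b2n Data.Bool.true  = 1
  b2n Data.Bool.false = 0

∣_∩_∣ : ∀ {k} → Label k → Label k → ℕ
∣ l ∩ l' ∣ = b2n ⌊ c₁ l ≟ c₁ l' ⌋ + b2n ⌊ c₁ l ≟ c₂ l' ⌋
           + b2n ⌊ c₂ l ≟ c₁ l' ⌋ + b2n ⌊ c₂ l ≟ c₂ l' ⌋

PartialLabelling : ∀ {n} → Graph n → ℕ → Set
PartialLabelling G k = Edge G → Maybe (Label k)

-- Partial 2-tone edge k-colouring: for distinct coloured e, e',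
-- |f(e) ∩ f(e')| < d_G(e,e'), i.e. no line-graph walk of length ≤ |f(e) ∩ f(e')|
-- (this also covers d = ∞ when e, e' lie in different components of L(G)).
IsPartial2Tone : ∀ {n} {G : Graph n} {k} → PartialLabelling G k → Set
IsPartial2Tone {G = G} {k} f =
  ∀ (e e' : Edge G) (l l' : Label k) → ¬ (e ≡ e') → f e ≡ just l → f e' ≡ just l' →
  ¬ DistLe ∣ l ∩ l' ∣ e e'

Free : ∀ {n} {G : Graph n} {k} → PartialLabelling G k → Edge G → Fin k → Set
Free {k = k} f e c = ∀ e' (l' : Label k) → LAdj e e' → f e' ≡ just l' → ¬ (c ∈L l')

Candidate : ∀ {n} {G : Graph n} {k} → PartialLabelling G k → Edge G → Label k → Set
Candidate f e l = Free f e (c₁ l) × Free f e (c₂ l)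

PairwiseIntersecting : ∀ {k} → List (Label k) → Set
PairwiseIntersecting {k} L =
  ∀ l l' → l Data.List.Membership.Propositional.∈ L → l' Data.List.Membership.Propositional.∈ L →
  ∃ λ (c : Fin k) → c ∈L l × c ∈L l'
  where import Data.List.Membership.Propositional

ExtendsWith : ∀ {n} {G : Graph n} {k} → PartialLabelling G k → Edge G → Label k →
              PartialLabelling G k → Set
ExtendsWith f e l g = g e ≡ just l × (∀ e' → ¬ (e' ≡ e) → g e' ≡ f e')

CanExtendWith : ∀ {n} {G : Graph n} {k} → PartialLabelling G k → Edge G → Label k → Set
CanExtendWith {G = G} {k} f e l =
  Σ (PartialLabelling G k) λ g → ExtendsWith f e l g × IsPartial2Tone g

nbhdUnionSize : ∀ {n} → Graph n → Fin n → Fin n → ℕ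
nbhdUnionSize {n} G x y = sum (map (λ v → if adj G x v ∨ adj G y v then 1 else 0) (allFin n))

η : ∀ {n} {G : Graph n} → Edge G → ℕ
η {G = G} e = nbhdUnionSize G (src e) (tgt e) ∸ 2

-- Let e = xy. Since the colours of a candidate label l are free at e, no coloured edge adjacent
-- to e shares a colour with l; so putting l on e can only violate the 2-tone condition against
-- an edge at distance 2 carrying l itself, i.e. an edge labelled l with an endpoint w in
-- N(x) ∪ N(y) ∖ {x, y}. Call l blocked at w. Two distinct labels of L cannot be blocked at the
-- same w: their edges would meet at w and, L being pairwise intersecting, share a colour. So the
-- blocked labels of L inject into N(x) ∪ N(y) ∖ {x, y}, a set of size η(e), and each of the
-- remaining at least |L| − η(e) labels extends f.

module Submission where

open import Defs hiding (sym)
open import Data.Nat using (ℕ; zero; suc; _+_; _∸_; _<_; _≤_; z≤n; s≤s)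
open import Data.Nat.Properties using (≤-trans; +-suc; ∸-monoˡ-≤; ∸-monoʳ-≤; m+n∸m≡n; module ≤-Reasoning)
open import Data.Fin using (Fin)
open import Data.Fin.Properties using (_≟_; _<?_; any?; <-irrelevant; <-irrefl; <-asym; <⇒≢)
open import Data.Bool using (Bool; true; false; T; _∨_; if_then_else_)
open import Data.Bool.Properties using (T-∨; T-irrelevant)
open import Data.List using (List; []; _∷_; length; map; filter; allFin)
open import Data.List.Properties using (filter-notAll)
open import Data.Nat.ListAction using (sum)
open import Data.List.Membership.Propositional using (_∈_)
open import Data.List.Membership.Propositional.Properties using (∈-filter⁺; ∈-filter⁻; ∈-allFin)
open import Data.List.Relation.Binary.Subset.Propositional using (_⊆_)
open import Data.List.Relation.Unary.Any as Any using (here; there)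
open import Data.List.Relation.Unary.All as All using (All; _∷_)
open import Data.List.Relation.Unary.All.Properties using (all-filter)
open import Data.List.Relation.Unary.AllPairs using (_∷_)
open import Data.List.Relation.Unary.Unique.Propositional using (Unique)
import Data.List.Relation.Unary.Unique.Propositional.Properties as Unique
open import Data.Maybe using (just; nothing)
open import Data.Maybe.Properties as Maybe using (just-injective)
open import Data.Empty using (⊥-elim)
open import Data.Sum using (_⊎_; inj₁; inj₂)
open import Data.Product using (Σ; ∃; _×_; _,_; proj₁; proj₂; uncurry)
open import Function using (_∘_; Equivalence)
open import Relation.Nullary using (¬_; Dec; yes; no)
open import Relation.Nullary.Decidable using (map′; _×-dec_; _⊎-dec_; ¬?; T?; decidable-stable)
open import Relation.Unary using (Pred; Decidable)
open import Relation.Unary.Properties using (∁?)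
open import Relation.Binary.Definitions using (DecidableEquality)
open import Relation.Binary.PropositionalEquality using (_≡_; refl; sym; trans; cong; cong₂; subst)

module _ {b} {B : Set b} (_≟ᴮ_ : DecidableEquality B) where

  injection⇒length≤ : ∀ {a} {A : Set a} {xs : List A} {ys : List B} → Unique xs →
    (h : ∀ {x} → x ∈ xs → B) →
    (∀ {x y} (p : x ∈ xs) (q : y ∈ xs) → h p ≡ h q → x ≡ y) →
    (∀ {x} (p : x ∈ xs) → h p ∈ ys) →
    length xs ≤ length ys
  injection⇒length≤ {xs = []} _ _ _ _ = z≤n
  injection⇒length≤ {xs = x ∷ xs} {ys} (x∉xs ∷ xs-unique) h h-injective h∈ys = begin
    suc (length xs)                ≤⟨ s≤s (injection⇒length≤ xs-unique (h ∘ there) h-injective′ h∈ys′) ⟩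
    suc (length (filter h₀≢? ys))  ≤⟨ filter-notAll h₀≢? ys (Any.map (λ h₀≡ h₀≢ → h₀≢ h₀≡) (h∈ys (here refl))) ⟩
    length ys                      ∎
    where
    open ≤-Reasoning
    h₀ : B
    h₀ = h (here refl)
    h₀≢? : Decidable (λ y → ¬ h₀ ≡ y)
    h₀≢? = ∁? (h₀ ≟ᴮ_)
    h-injective′ : ∀ {x y} (p : x ∈ xs) (q : y ∈ xs) → h (there p) ≡ h (there q) → x ≡ y
    h-injective′ p q = h-injective (there p) (there q)
    h∈ys′ : ∀ {y} (p : y ∈ xs) → h (there p) ∈ filter h₀≢? ys
    h∈ys′ p = ∈-filter⁺ h₀≢? (h∈ys (there p))
                (λ eq → All.lookup x∉xs p (h-injective (here refl) (there p) eq))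

  Unique-⊆⇒length≤ : ∀ {xs ys : List B} → Unique xs → xs ⊆ ys → length xs ≤ length ys
  Unique-⊆⇒length≤ xs-unique xs⊆ys = injection⇒length≤ xs-unique (λ {x} _ → x) (λ _ _ eq → eq) xs⊆ys

length-filter+length-filter-∁ : ∀ {a p} {A : Set a} {P : Pred A p} (P? : Decidable P) (xs : List A) →
  length (filter P? xs) + length (filter (∁? P?) xs) ≡ length xs
length-filter+length-filter-∁ P? [] = refl
length-filter+length-filter-∁ P? (x ∷ xs) with P? x
... | yes _ = cong suc (length-filter+length-filter-∁ P? xs)
... | no _  = trans (+-suc _ _) (cong suc (length-filter+length-filter-∁ P? xs))

sum-indicator≡length-filter : ∀ {a} {A : Set a} (b : A → Bool) (xs : List A) →
  sum (map (λ v → if b v then 1 else 0) xs) ≡ length (filter (T? ∘ b) xs)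
sum-indicator≡length-filter b [] = refl
sum-indicator≡length-filter b (x ∷ xs) with b x
... | true  = cong suc (sum-indicator≡length-filter b xs)
... | false = sum-indicator≡length-filter b xs

module _ {n : ℕ} {G : Graph n} where

  edge-≡ : ∀ {d d' : Edge G} → src d ≡ src d' → tgt d ≡ tgt d' → d ≡ d'
  edge-≡ {edge u v _ _} {edge .u .v _ _} refl refl = cong₂ (edge u v) (<-irrelevant _ _) (T-irrelevant _ _)

  _≟ₑ_ : DecidableEquality (Edge G)
  d ≟ₑ d' = map′ (uncurry edge-≡) (λ eq → cong src eq , cong tgt eq) (src d ≟ src d' ×-dec tgt d ≟ tgt d')

  _endOf?_ : ∀ w (d : Edge G) → Dec (w endOf d)
  w endOf? d = (w ≟ src d) ⊎-dec (w ≟ tgt d)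

  ∃-edge? : ∀ {p} {P : Pred (Edge G) p} → Decidable P → Dec (∃ P)
  ∃-edge? {P = P} P? =
    map′ (λ (u , v , u<v , uv∈E , Puv) → edge u v u<v uv∈E , Puv)
         (λ (edge u v u<v uv∈E , Puv) → u , v , u<v , uv∈E , Puv)
         (any? λ u → any? λ v → edge? u v)
    where
    edge? : ∀ u v → Dec (Σ (Data.Fin._<_ u v) λ u<v → Σ (T (adj G u v)) λ uv∈E → P (edge u v u<v uv∈E))
    edge? u v with u <? v | T? (adj G u v)
    ... | no u≮v  | _         = no (u≮v ∘ proj₁)
    ... | yes _   | no uv∉E   = no (uv∉E ∘ proj₁ ∘ proj₂)
    ... | yes u<v | yes uv∈E  =
      map′ (λ Puv → u<v , uv∈E , Puv)
           (λ (_ , _ , Puv) → subst P (edge-≡ refl refl) Puv)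
           (P? (edge u v u<v uv∈E))

  endpoints-adjacent : ∀ {a b} (d : Edge G) → a endOf d → b endOf d → ¬ a ≡ b → T (adj G a b)
  endpoints-adjacent d (inj₁ refl) (inj₁ refl) a≢b = ⊥-elim (a≢b refl)
  endpoints-adjacent d (inj₁ refl) (inj₂ refl) _   = isE d
  endpoints-adjacent d (inj₂ refl) (inj₁ refl) _   = subst T (Graph.sym G (src d) (tgt d)) (isE d)
  endpoints-adjacent d (inj₂ refl) (inj₂ refl) a≢b = ⊥-elim (a≢b refl)

  LAdj-sym : ∀ {d d' : Edge G} → LAdj d d' → LAdj d' d
  LAdj-sym (d≢d' , w , w∈d , w∈d') = d≢d' ∘ sym , w , w∈d' , w∈d

  DistLe₁⇒LAdj : ∀ {d d' : Edge G} → ¬ d ≡ d' → DistLe 1 d d' → LAdj d d'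
  DistLe₁⇒LAdj d≢d' (inj₁ d≡d')             = ⊥-elim (d≢d' d≡d')
  DistLe₁⇒LAdj _    (inj₂ (_ , d~d' , refl)) = d~d'

  DistLe-snoc : ∀ m {d d' d'' : Edge G} → DistLe m d d' → LAdj d' d'' → DistLe (suc m) d d''
  DistLe-snoc zero    refl                  d'~d'' = inj₂ (_ , d'~d'' , refl)
  DistLe-snoc (suc m) (inj₁ d≤d')           d'~d'' = inj₁ (DistLe-snoc m d≤d' d'~d'')
  DistLe-snoc (suc m) (inj₂ (c , d~c , c≤d')) d'~d'' = inj₂ (c , d~c , DistLe-snoc m c≤d' d'~d'')

  DistLe-sym : ∀ m {d d' : Edge G} → DistLe m d d' → DistLe m d' d
  DistLe-sym zero    refl                    = refl
  DistLe-sym (suc m) (inj₁ d≤d')             = inj₁ (DistLe-sym m d≤d')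
  DistLe-sym (suc m) (inj₂ (c , d~c , c≤d')) = DistLe-snoc m (DistLe-sym m c≤d') (LAdj-sym d~c)

module _ {k : ℕ} where

  label-≡ : ∀ {l l' : Label k} → c₁ l ≡ c₁ l' → c₂ l ≡ c₂ l' → l ≡ l'
  label-≡ {label a b _} {label .a .b _} refl refl = cong (label a b) (<-irrelevant _ _)

  _≟ₗ_ : DecidableEquality (Label k)
  l ≟ₗ l' = map′ (uncurry label-≡) (λ eq → cong c₁ eq , cong c₂ eq) (c₁ l ≟ c₁ l' ×-dec c₂ l ≟ c₂ l')

  SharesColour : Label k → Label k → Set
  SharesColour l l' = ∃ λ c → c ∈L l × c ∈L l'

  SharesColour-refl : ∀ {l} → SharesColour l l
  SharesColour-refl {l} = c₁ l , inj₁ refl , inj₁ refl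

  SharesColour-sym : ∀ {l l'} → SharesColour l l' → SharesColour l' l
  SharesColour-sym (c , c∈l , c∈l') = c , c∈l' , c∈l

  data IntersectionView (l l' : Label k) : ℕ → Set where
    disjoint : ¬ SharesColour l l' → IntersectionView l l' 0
    single   : SharesColour l l' → IntersectionView l l' 1
    equal    : l ≡ l' → IntersectionView l l' 2

  IntersectionView-sym : ∀ {l l' m} → IntersectionView l l' m → IntersectionView l' l m
  IntersectionView-sym {l} {l'} (disjoint l∩l'=∅) = disjoint (l∩l'=∅ ∘ SharesColour-sym {l = l'} {l})
  IntersectionView-sym {l} {l'} (single shared)   = single (SharesColour-sym {l = l} {l'} shared)
  IntersectionView-sym          (equal l≡l')      = equal (sym l≡l')

  intersectionView : ∀ l l' → IntersectionView l l' ∣ l ∩ l' ∣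
  intersectionView (label a b a<b) (label a' b' a'<b') with a ≟ a' | a ≟ b' | b ≟ a' | b ≟ b'
  ... | yes refl | yes refl | _        | _        = ⊥-elim (<-irrefl refl a'<b')
  ... | _        | _        | yes refl | yes refl = ⊥-elim (<-irrefl refl a'<b')
  ... | yes refl | _        | yes refl | _        = ⊥-elim (<-irrefl refl a<b)
  ... | _        | yes refl | _        | yes refl = ⊥-elim (<-irrefl refl a<b)
  ... | _        | yes refl | yes refl | _        = ⊥-elim (<-asym a<b a'<b')
  ... | yes refl | no _     | no _     | yes refl = equal (label-≡ refl refl)
  ... | yes refl | no _     | no _     | no _     = single (a , inj₁ refl , inj₁ refl)
  ... | no _     | yes refl | no _     | no _     = single (a , inj₁ refl , inj₂ refl)
  ... | no _     | no _     | yes refl | no _     = single (b , inj₂ refl , inj₁ refl)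
  ... | no _     | no _     | no _     | yes refl = single (b , inj₂ refl , inj₂ refl)
  ... | no a≢a'  | no a≢b'  | no b≢a'  | no b≢b'  = disjoint λ
    { (_ , inj₁ refl , inj₁ refl) → a≢a' refl
    ; (_ , inj₁ refl , inj₂ refl) → a≢b' refl
    ; (_ , inj₂ refl , inj₁ refl) → b≢a' refl
    ; (_ , inj₂ refl , inj₂ refl) → b≢b' refl
    }

module _ {n k : ℕ} {G : Graph n} where

  LAdj⇒DistLe : ∀ {l l' : Label k} {m} {d d' : Edge G} →
    IntersectionView l l' m → SharesColour l l' → LAdj d d' → DistLe m d d'
  LAdj⇒DistLe (disjoint l∩l'=∅) shared _ = ⊥-elim (l∩l'=∅ shared)
  LAdj⇒DistLe (single _)        _ d~d'   = inj₂ (_ , d~d' , refl)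
  LAdj⇒DistLe (equal _)         _ d~d'   = inj₁ (inj₂ (_ , d~d' , refl))

  incident-sharing⇒≡ : ∀ {f : PartialLabelling G k} → IsPartial2Tone f →
    ∀ {d d' l l' w} → f d ≡ just l → f d' ≡ just l' → w endOf d → w endOf d' → SharesColour l l' → d ≡ d'
  incident-sharing⇒≡ f-2tone {d} {d'} {l} {l'} {w} fd fd' w∈d w∈d' shared =
    decidable-stable (d ≟ₑ d') λ d≢d' →
      f-2tone d d' l l' d≢d' fd fd' (LAdj⇒DistLe (intersectionView l l') shared (d≢d' , w , w∈d , w∈d'))

  assign : Edge G → Label k → PartialLabelling G k → PartialLabelling G k
  assign e l f d with d ≟ₑ e
  ... | yes _ = just l
  ... | no _  = f d

  module _ {e : Edge G} {l : Label k} {f : PartialLabelling G k} where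

    assign-extends : ExtendsWith f e l (assign e l f)
    assign-extends = at-e , elsewhere
      where
      at-e : assign e l f e ≡ just l
      at-e with e ≟ₑ e
      ... | yes _  = refl
      ... | no e≢e = ⊥-elim (e≢e refl)
      elsewhere : ∀ d → ¬ d ≡ e → assign e l f d ≡ f d
      elsewhere d d≢e with d ≟ₑ e
      ... | yes d≡e = ⊥-elim (d≢e d≡e)
      ... | no _    = refl

    assign-inv : ∀ d {l'} → assign e l f d ≡ just l' → (d ≡ e × l ≡ l') ⊎ (¬ d ≡ e × f d ≡ just l')
    assign-inv d eq with d ≟ₑ e
    ... | yes d≡e = inj₁ (d≡e , just-injective eq)
    ... | no d≢e  = inj₂ (d≢e , eq)

  -- Quantifying over views rather than over ∣ l ∩ l' ∣ lets this one condition cover both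
  -- orientations of the 2-tone requirement, as ∣_∩_∣ is not definitionally symmetric.
  Compatible : PartialLabelling G k → Edge G → Label k → Set
  Compatible f e l = ∀ {d l' m} → ¬ d ≡ e → f d ≡ just l' → IntersectionView l l' m → ¬ DistLe m e d

  compatible⇒extendable : ∀ {f e l} → IsPartial2Tone f → Compatible f e l → CanExtendWith f e l
  compatible⇒extendable {f} {e} {l} f-2tone compatible = assign e l f , assign-extends , 2tone
    where
    2tone : IsPartial2Tone (assign e l f)
    2tone d d' l₁ l₂ d≢d' gd gd' with assign-inv {e = e} {l} {f} d gd | assign-inv {e = e} {l} {f} d' gd'
    ... | inj₁ (refl , _)    | inj₁ (refl , _)     = ⊥-elim (d≢d' refl)
    ... | inj₁ (refl , refl) | inj₂ (d'≢e , fd')   = compatible d'≢e fd' (intersectionView l₁ l₂)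
    ... | inj₂ (d≢e , fd)    | inj₁ (refl , refl)  =
      compatible d≢e fd (IntersectionView-sym (intersectionView l₁ l₂)) ∘ DistLe-sym ∣ l₁ ∩ l₂ ∣
    ... | inj₂ (_ , fd)      | inj₂ (_ , fd')      = f-2tone d d' l₁ l₂ d≢d' fd fd'

module AtUncolouredEdge {n k : ℕ} {G : Graph n} {f : PartialLabelling G k} {e : Edge G}
  (f-2tone : IsPartial2Tone f) (fe : f e ≡ nothing) where

  nearᵇ : Fin n → Bool
  nearᵇ w = adj G (src e) w ∨ adj G (tgt e) w

  Near : Fin n → Set
  Near = T ∘ nearᵇ

  near? : Decidable Near
  near? = T? ∘ nearᵇ

  neighbour-near : ∀ {v w} → v endOf e → T (adj G v w) → Near w
  neighbour-near (inj₁ refl) vw∈E = Equivalence.from T-∨ (inj₁ vw∈E)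
  neighbour-near (inj₂ refl) vw∈E = Equivalence.from T-∨ (inj₂ vw∈E)

  endpoint-near : ∀ {w} → w endOf e → Near w
  endpoint-near (inj₁ refl) =
    neighbour-near (inj₂ refl) (endpoints-adjacent e (inj₂ refl) (inj₁ refl) (<⇒≢ (ord e) ∘ sym))
  endpoint-near (inj₂ refl) = neighbour-near (inj₁ refl) (isE e)

  LAdj-endpoint-near : ∀ {d w} → LAdj e d → w endOf d → Near w
  LAdj-endpoint-near {d} {w} (_ , v , v∈e , v∈d) w∈d with v ≟ w
  ... | yes refl = endpoint-near v∈e
  ... | no v≢w   = neighbour-near v∈e (endpoints-adjacent d v∈d w∈d v≢w)

  Blocked : Label k → Set
  Blocked l = ∃ λ d → f d ≡ just l × ∃ λ w → w endOf d × Near w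

  blocked? : Decidable Blocked
  blocked? l = ∃-edge? λ d → Maybe.≡-dec _≟ₗ_ (f d) (just l) ×-dec any? λ w → (w endOf? d) ×-dec near? w

  blocking-vertex : ∀ {l} → Blocked l → Fin n
  blocking-vertex (_ , _ , w , _) = w

  blocking-vertex-near : ∀ {l} (b : Blocked l) → Near (blocking-vertex b)
  blocking-vertex-near (_ , _ , _ , _ , w-near) = w-near

  coloured⇒≢e : ∀ {d l} → f d ≡ just l → ¬ d ≡ e
  coloured⇒≢e fd refl with trans (sym fd) fe
  ... | ()

  candidate-apart : ∀ {l l' d} → Candidate f e l → SharesColour l l' → f d ≡ just l' → ¬ LAdj e d
  candidate-apart (free₁ , _) (_ , inj₁ refl , c∈l') fd e~d = free₁ _ _ e~d fd c∈l'
  candidate-apart (_ , free₂) (_ , inj₂ refl , c∈l') fd e~d = free₂ _ _ e~d fd c∈l'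

  candidate-label-not-adjacent : ∀ {l d} → Candidate f e l → f d ≡ just l → ¬ LAdj e d
  candidate-label-not-adjacent {l} cand = candidate-apart {l} cand (SharesColour-refl {l = l})

  unblocked-compatible : ∀ {l} → Candidate f e l → ¬ Blocked l → Compatible f e l
  unblocked-compatible _ _ d≢e _ (disjoint _) e≡d = d≢e (sym e≡d)
  unblocked-compatible {l} cand _ d≢e fd (single shared) e≤₁d =
    candidate-apart {l} cand shared fd (DistLe₁⇒LAdj (d≢e ∘ sym) e≤₁d)
  unblocked-compatible {l} cand _ d≢e fd (equal refl) (inj₁ e≤₁d) =
    candidate-label-not-adjacent {l} cand fd (DistLe₁⇒LAdj (d≢e ∘ sym) e≤₁d)
  unblocked-compatible {l} cand _ _ fd (equal refl) (inj₂ (_ , e~d , inj₁ refl)) =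
    candidate-label-not-adjacent {l} cand fd e~d
  unblocked-compatible _ unblocked _ fd (equal refl)
    (inj₂ (_ , e~d' , inj₂ (d , (_ , w , w∈d' , w∈d) , refl))) =
    unblocked (d , fd , w , w∈d , LAdj-endpoint-near e~d' w∈d')

  unblocked-candidate-extends : ∀ {l} → Candidate f e l → ¬ Blocked l → CanExtendWith f e l
  unblocked-candidate-extends cand unblocked =
    compatible⇒extendable f-2tone (unblocked-compatible cand unblocked)

  blocking-vertex∉e : ∀ {l} → Candidate f e l → (b : Blocked l) → ¬ blocking-vertex b endOf e
  blocking-vertex∉e {l} cand (d , fd , w , w∈d , _) w∈e =
    candidate-label-not-adjacent {l} cand fd (coloured⇒≢e fd ∘ sym , w , w∈e , w∈d)

  blocking-vertex-injective : ∀ {l l'} → SharesColour l l' → (b : Blocked l) (b' : Blocked l') →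
    blocking-vertex b ≡ blocking-vertex b' → l ≡ l'
  blocking-vertex-injective shared (d , fd , w , w∈d , _) (d' , fd' , _ , w∈d' , _) refl =
    just-injective (trans (sym fd) (trans (cong f d≡d') fd'))
    where
    d≡d' : d ≡ d'
    d≡d' = incident-sharing⇒≡ f-2tone fd fd' w∈d w∈d' shared

  NearOutside : Fin n → Set
  NearOutside w = Near w × ¬ w endOf e

  nearOutside? : Decidable NearOutside
  nearOutside? w = near? w ×-dec ¬? (w endOf? e)

  nearOutside≤η : length (filter nearOutside? (allFin n)) ≤ η e
  nearOutside≤η = ∸-monoˡ-≤ 2 (begin
    length (src e ∷ tgt e ∷ outside)  ≤⟨ Unique-⊆⇒length≤ _≟_ unique (∈-filter⁺ near? (∈-allFin _) ∘ near-of) ⟩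
    length (filter near? (allFin n))  ≡⟨ sym (sum-indicator≡length-filter nearᵇ (allFin n)) ⟩
    nbhdUnionSize G (src e) (tgt e)   ∎)
    where
    open ≤-Reasoning
    outside : List (Fin n)
    outside = filter nearOutside? (allFin n)
    avoid-e : All NearOutside outside
    avoid-e = all-filter nearOutside? (allFin n)
    unique : Unique (src e ∷ tgt e ∷ outside)
    unique = (<⇒≢ (ord e) ∷ All.map (λ (_ , w∉e) x≡w → w∉e (inj₁ (sym x≡w))) avoid-e)
           ∷ All.map (λ (_ , w∉e) y≡w → w∉e (inj₂ (sym y≡w))) avoid-e
           ∷ Unique.filter⁺ nearOutside? (Unique.allFin⁺ n)
    near-of : ∀ {w} → w ∈ (src e ∷ tgt e ∷ outside) → Near w
    near-of (here refl)         = endpoint-near (inj₁ refl)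
    near-of (there (here refl)) = endpoint-near (inj₂ refl)
    near-of (there (there p))   = proj₁ (All.lookup avoid-e p)

  blocked≤η : ∀ {L} → Unique L → All (Candidate f e) L → PairwiseIntersecting L →
    length (filter blocked? L) ≤ η e
  blocked≤η {L} L-unique candidates intersecting =
    ≤-trans (injection⇒length≤ _≟_ (Unique.filter⁺ blocked? L-unique) vertex vertex-injective vertex-outside)
            nearOutside≤η
    where
    blocked-member : ∀ {l} → l ∈ filter blocked? L → l ∈ L × Blocked l
    blocked-member = ∈-filter⁻ blocked?
    vertex : ∀ {l} → l ∈ filter blocked? L → Fin n
    vertex p = blocking-vertex (proj₂ (blocked-member p))
    vertex-injective : ∀ {l l'} (p : l ∈ filter blocked? L) (q : l' ∈ filter blocked? L) →
      vertex p ≡ vertex q → l ≡ l'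
    vertex-injective p q = blocking-vertex-injective
      (intersecting _ _ (proj₁ (blocked-member p)) (proj₁ (blocked-member q)))
      (proj₂ (blocked-member p)) (proj₂ (blocked-member q))
    vertex-outside : ∀ {l} (p : l ∈ filter blocked? L) → vertex p ∈ filter nearOutside? (allFin n)
    vertex-outside {l} p = ∈-filter⁺ nearOutside? (∈-allFin _)
      (blocking-vertex-near b , blocking-vertex∉e (All.lookup candidates (proj₁ (blocked-member p))) b)
      where
      b : Blocked l
      b = proj₂ (blocked-member p)

mainTheorem10 : ∀ {n k : ℕ} (G : Graph n) (f : PartialLabelling G k) (e : Edge G)
    (L : List (Label k)) →
    IsPartial2Tone f → f e ≡ nothing →
    Unique L → All (Candidate f e) L → PairwiseIntersecting L →
    η e < length L →
    Σ (List (Label k)) λ M →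
      Unique M × All (CanExtendWith f e) M × length L ∸ η e ≤ length M
mainTheorem10 {k = k} G f e L f-2tone fe L-unique candidates intersecting _ =
  M , Unique.filter⁺ (∁? blocked?) L-unique , All.tabulate extendable , bound
  where
  open AtUncolouredEdge f-2tone fe
  open ≤-Reasoning
  B M : List (Label k)
  B = filter blocked? L
  M = filter (∁? blocked?) L
  extendable : ∀ {l} → l ∈ M → CanExtendWith f e l
  extendable p = let l∈L , unblocked = ∈-filter⁻ (∁? blocked?) p in
    unblocked-candidate-extends (All.lookup candidates l∈L) unblocked
  bound : length L ∸ η e ≤ length M
  bound = begin
    length L ∸ η e                 ≤⟨ ∸-monoʳ-≤ (length L) (blocked≤η L-unique candidates intersecting) ⟩
    length L ∸ length B            ≡⟨ cong (_∸ length B) (sym (length-filter+length-filter-∁ blocked? L)) ⟩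
    length B + length M ∸ length B ≡⟨ m+n∸m≡n (length B) (length M) ⟩
    length M                       ∎
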